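{- Let $\sigma,\theta$ be substitutions and $\alpha$ a prenaming safe for both $\sigma$ and $\theta$. Then $\alpha(\sigma\circ\theta)=\alpha(\sigma)\circ\alpha(\theta)$.
   Context: $V$ is a countably infinite set of variables. A substitution maps variables to terms with finite active domain $\mathrm{Dom}(\theta)=\{x:\theta(x)\neq x\}$, extended homomorphically to terms; $(\theta\circ\sigma)(x)=\theta(\sigma(x))$; $\mathrm{vars}(\theta)=\mathrm{Dom}(\theta)\cup\mathrm{vars}(\theta(\mathrm{Dom}(\theta)))$. A prenaming is a substitution $\alpha$ mapping variables to variables together with a fixed finite set $C^+(\alpha)\supseteq\mathrm{Dom}(\alpha)$ (relaxed core) on which $\alpha$ is injective; $R^+(\alpha)=\alpha(C^+(\alpha))$. $\mathrm{indom}(\alpha)=V\setminus(R^+(\alpha)\setminus C^+(\alpha))$; $\alpha$ is safe for a substitution $\sigma$ if $\mathrm{vars}(\sigma)\subseteq\mathrm{indom}(\alpha)$. The substitution variant is $\alpha(\sigma):=\{\alpha(x)/\alpha(\sigma(x)):x\in\mathrm{Dom}(\sigma)\}$, i.e. the substitution sending $\alpha(x)$ to $\alpha(\sigma(x))$ for $x\in\mathrm{Dom}(\sigma)$ and identity elsewhere. -}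

module Defs where

open import Data.Nat using (ℕ; _≟_)
open import Data.Vec using (Vec; []; _∷_)
open import Data.List using (List; []; _∷_; _++_; map)
open import Data.List.Membership.Propositional using (_∈_; _∉_)
open import Data.List.Membership.Propositional.Properties using (∈-++⁺ˡ; ∈-++⁺ʳ; ∈-map⁺)
open import Data.List.Relation.Unary.Any using (here; there)
open import Data.Product using (Σ; _×_; _,_; ∃)
open import Data.Sum using (_⊎_)
open import Relation.Nullary using (¬_; Dec; yes; no; contradiction)
open import Relation.Binary.PropositionalEquality using (_≡_; _≢_; refl; cong; sym)

data Term (F : ℕ → Set) : Set where
  var : ℕ → Term F
  fn  : ∀ {n} → F n → Vec (Term F) n → Term F

module _ {F : ℕ → Set} where

  mutual
    data _∈vars_ (y : ℕ) : Term F → Set where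
      vhere  : y ∈vars var y
      vthere : ∀ {n} {f : F n} {ts} → y ∈vars* ts → y ∈vars fn f ts

    data _∈vars*_ (y : ℕ) : ∀ {n} → Vec (Term F) n → Set where
      vhd : ∀ {n t} {ts : Vec (Term F) n} → y ∈vars t → y ∈vars* (t ∷ ts)
      vtl : ∀ {n t} {ts : Vec (Term F) n} → y ∈vars* ts → y ∈vars* (t ∷ ts)

  mutual
    _⟪_⟫ : (ℕ → Term F) → Term F → Term F
    s ⟪ var x ⟫ = s x
    s ⟪ fn f ts ⟫ = fn f (s ⟪ ts ⟫*)

    _⟪_⟫* : ∀ {n} → (ℕ → Term F) → Vec (Term F) n → Vec (Term F) n
    s ⟪ [] ⟫* = []
    s ⟪ t ∷ ts ⟫* = (s ⟪ t ⟫) ∷ (s ⟪ ts ⟫*)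

  var-inj : ∀ {x y} → var {F} x ≡ var y → x ≡ y
  var-inj refl = refl

  isVar? : (t : Term F) (x : ℕ) → Dec (t ≡ var x)
  isVar? (var y) x with y ≟ x
  ... | yes refl = yes refl
  ... | no y≢x = no (λ eq → y≢x (var-inj eq))
  isVar? (fn f ts) x = no (λ ())

-- A substitution: a map from variables to terms with finite active domain,
-- witnessed by a finite list containing every x with σ(x) ≠ x.
record Subst (F : ℕ → Set) : Set where
  field
    app     : ℕ → Term F
    supp    : List ℕ
    supp-ok : ∀ x → app x ≢ var x → x ∈ supp
open Subst public

module _ {F : ℕ → Set} where

  Dom : Subst F → ℕ → Set
  Dom σ x = app σ x ≢ var x

  VarsS : Subst F → ℕ → Set
  VarsS σ y = Dom σ y ⊎ Σ ℕ (λ x → Dom σ x × y ∈vars app σ x)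

  _∘ˢ_ : Subst F → Subst F → Subst F
  app (σ ∘ˢ θ) x = app σ ⟪ app θ x ⟫
  supp (σ ∘ˢ θ) = supp θ ++ supp σ
  supp-ok (σ ∘ˢ θ) x ne with isVar? (app θ x) x
  ... | no θx≢x = ∈-++⁺ˡ (supp-ok θ x θx≢x)
  ... | yes eq rewrite eq = ∈-++⁺ʳ (supp θ) (supp-ok σ x ne)

-- A prenaming: a variable renaming α with a finite relaxed core C⁺(α) ⊇ Dom(α)
-- on which α is injective.
record Prenaming : Set where
  field
    ren      : ℕ → ℕ
    core     : List ℕ
    dom⊆core : ∀ x → ren x ≢ x → x ∈ core
    inj      : ∀ x y → x ∈ core → y ∈ core → ren x ≡ ren y → x ≡ y
open Prenaming public

R⁺ : Prenaming → ℕ → Set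
R⁺ α y = Σ ℕ (λ x → x ∈ core α × ren α x ≡ y)

indom : Prenaming → ℕ → Set
indom α y = ¬ (R⁺ α y × y ∉ core α)

Safe : ∀ {F} → Prenaming → Subst F → Set
Safe α σ = ∀ y → VarsS σ y → indom α y

module _ {F : ℕ → Set} where

  renT : Prenaming → Term F → Term F
  renT α t = (λ x → var (ren α x)) ⟪ t ⟫

  -- the value of the variant α(σ) at y: α(σ(x)) if y = α(x) for some
  -- x ∈ Dom(σ) (the first such x in the support list), and y otherwise.
  variantAt : Prenaming → (σ : Subst F) → List ℕ → ℕ → Term F
  variantAt α σ [] y = var y
  variantAt α σ (x ∷ xs) y with ren α x ≟ y | isVar? (app σ x) x
  ... | yes _ | no _ = renT α (app σ x)
  ... | _     | _    = variantAt α σ xs y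

  variantAt-ok : ∀ α σ xs y → variantAt α σ xs y ≢ var y → y ∈ map (ren α) xs
  variantAt-ok α σ [] y ne = contradiction refl ne
  variantAt-ok α σ (x ∷ xs) y ne with ren α x ≟ y | isVar? (app σ x) x
  ... | yes refl | no _ = here refl
  ... | yes _ | yes _ = there (variantAt-ok α σ xs y ne)
  ... | no _  | _     = there (variantAt-ok α σ xs y ne)

  -- substitution variant α(σ) = { α(x)/α(σ(x)) : x ∈ Dom(σ) }
  variant : Prenaming → Subst F → Subst F
  app (variant α σ) = variantAt α σ (supp σ)
  supp (variant α σ) = map (ren α) (supp σ)
  supp-ok (variant α σ) y ne = variantAt-ok α σ (supp σ) y ne

  _≐_ : Subst F → Subst F → Set
  σ ≐ θ = ∀ x → app σ x ≡ app θ x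

module Submission where

-- Safety makes α injective on the variables that matter: α is injective on
-- indom(α) (`indom-injective`), and every variable of σ and θ lies in indom(α).
-- From injectivity we read off α(σ) pointwise (`variant-at-image`):
-- α(σ)(α(x)) = α(σ(x)) for every x ∈ indom(α), and α(σ)(y) = y when y is not
-- the α-image of a domain variable (`variant-off-image`).  Extending the first
-- fact homomorphically gives α(σ)(α(t)) = α(σ(t)) for terms t over indom(α)
-- (`variant-renT`).  The theorem is then checked at each variable y, split by
-- whether y is the α-image of a variable of Dom(σ) ∪ Dom(θ) (`image?`):
-- in that case both sides equal α(σ(θ(x))), otherwise both sides fix y.

open import Defs
open import Data.Nat using (ℕ; _≟_)
open import Data.Vec using (Vec; []; _∷_)
open import Data.List using ([]; _∷_; _++_)
open import Data.List.Membership.Propositional using (_∈_; _∉_; find; lose)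
open import Data.List.Membership.Propositional.Properties using (∈-++⁺ˡ; ∈-++⁺ʳ)
open import Data.List.Membership.DecPropositional _≟_ using (_∈?_)
open import Data.List.Relation.Unary.Any using (here; there; any?)
open import Data.Product using (Σ; _×_; _,_)
open import Data.Sum using (_⊎_; inj₁; inj₂; [_,_])
open import Data.Empty using (⊥-elim)
open import Relation.Nullary using (Dec; yes; no; contradiction)
open import Relation.Nullary.Decidable using (¬?; _×-dec_; _⊎-dec_)
open import Relation.Binary.PropositionalEquality
  using (_≡_; _≢_; refl; cong; cong₂; sym; trans; module ≡-Reasoning)

ren-outside-core : ∀ α {x} → x ∉ core α → ren α x ≡ x
ren-outside-core α {x} x∉core with ren α x ≟ x
... | yes fixed = fixed
... | no moved  = contradiction (dom⊆core α x moved) x∉core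

-- α is injective on indom(α): two core variables are separated by injectivity
-- on the core, two non-core variables are fixed, and a core variable cannot
-- share its image with a non-core variable y, as y would lie in R⁺(α) ∖ C⁺(α).
indom-injective : ∀ α {x x'} → indom α x → indom α x' → ren α x ≡ ren α x' → x ≡ x'
indom-injective α {x} {x'} ix ix' eq with x ∈? core α | x' ∈? core α
... | yes x∈ | yes x'∈ = inj α x x' x∈ x'∈ eq
... | yes x∈ | no x'∉  = ⊥-elim (ix' ((x , x∈ , trans eq (ren-outside-core α x'∉)) , x'∉))
... | no x∉  | yes x'∈ = ⊥-elim (ix ((x' , x'∈ , trans (sym eq) (ren-outside-core α x∉)) , x∉))
... | no x∉  | no x'∉  = trans (sym (ren-outside-core α x∉)) (trans eq (ren-outside-core α x'∉))

module _ {F : ℕ → Set} where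

  mutual
    subst-cong : ∀ (f g : ℕ → Term F) t → (∀ z → z ∈vars t → f z ≡ g z) → f ⟪ t ⟫ ≡ g ⟪ t ⟫
    subst-cong f g (var x)   agree = agree x vhere
    subst-cong f g (fn s ts) agree = cong (fn s) (subst-cong* f g ts (λ z p → agree z (vthere p)))

    subst-cong* : ∀ {n} (f g : ℕ → Term F) (ts : Vec (Term F) n) →
                  (∀ z → z ∈vars* ts → f z ≡ g z) → f ⟪ ts ⟫* ≡ g ⟪ ts ⟫*
    subst-cong* f g []       agree = refl
    subst-cong* f g (t ∷ ts) agree =
      cong₂ _∷_ (subst-cong f g t (λ z p → agree z (vhd p))) (subst-cong* f g ts (λ z p → agree z (vtl p)))

  mutual
    subst-comp : ∀ (f g : ℕ → Term F) t → f ⟪ g ⟪ t ⟫ ⟫ ≡ (λ z → f ⟪ g z ⟫) ⟪ t ⟫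
    subst-comp f g (var x)   = refl
    subst-comp f g (fn s ts) = cong (fn s) (subst-comp* f g ts)

    subst-comp* : ∀ {n} (f g : ℕ → Term F) (ts : Vec (Term F) n) →
                  f ⟪ g ⟪ ts ⟫* ⟫* ≡ (λ z → f ⟪ g z ⟫) ⟪ ts ⟫*
    subst-comp* f g []       = refl
    subst-comp* f g (t ∷ ts) = cong₂ _∷_ (subst-comp f g t) (subst-comp* f g ts)

  Dom? : ∀ (σ : Subst F) x → Dec (Dom σ x)
  Dom? σ x = ¬? (isVar? (app σ x) x)

  -- The domain of σ lies inside indom(α); this is the part of safety that
  -- governs the shape of the variant α(σ).
  DomSafe : Prenaming → Subst F → Set
  DomSafe α σ = ∀ x → Dom σ x → indom α x

  Safe⇒DomSafe : ∀ α (σ : Subst F) → Safe α σ → DomSafe α σ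
  Safe⇒DomSafe α σ safe x x∈Dom = safe x (inj₁ x∈Dom)

  Safe⇒vars-indom : ∀ α (θ : Subst F) → Safe α θ → ∀ {x} → indom α x → ∀ z → z ∈vars app θ x → indom α z
  Safe⇒vars-indom α θ safe {x} ix z z∈θx with isVar? (app θ x) x
  ... | no x∈Dom = safe z (inj₂ (x , x∈Dom , z∈θx))
  ... | yes θx≡x rewrite θx≡x with z∈θx
  ...   | vhere = ix

  Dom-∘ : ∀ (σ θ : Subst F) {x} → Dom (σ ∘ˢ θ) x → Dom σ x ⊎ Dom θ x
  Dom-∘ σ θ {x} x∈Dom with isVar? (app θ x) x
  ... | yes θx≡x = inj₁ (λ σx≡x → x∈Dom (trans (cong (app σ ⟪_⟫) θx≡x) σx≡x))
  ... | no x∈Domθ = inj₂ x∈Domθ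

  variantAt-off-image : ∀ α (σ : Subst F) {y} → (∀ x → Dom σ x → ren α x ≢ y) →
                        ∀ xs → variantAt α σ xs y ≡ var y
  variantAt-off-image α σ off []       = refl
  variantAt-off-image α σ {y} off (x ∷ xs) with ren α x ≟ y | isVar? (app σ x) x
  ... | yes αx≡y | no x∈Dom = contradiction αx≡y (off x x∈Dom)
  ... | yes _    | yes _    = variantAt-off-image α σ off xs
  ... | no _     | _        = variantAt-off-image α σ off xs

  variant-off-image : ∀ α (σ : Subst F) {y} → (∀ x → Dom σ x → ren α x ≢ y) → app (variant α σ) y ≡ var y
  variant-off-image α σ off = variantAt-off-image α σ off (supp σ)

  ∈-tail : ∀ {x x₀ : ℕ} {xs} → x ∈ x₀ ∷ xs → x₀ ≢ x → x ∈ xs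
  ∈-tail (here refl)  x₀≢x = contradiction refl x₀≢x
  ∈-tail (there x∈xs) _    = x∈xs

  variantAt-at-image : ∀ α (σ : Subst F) {x} → Dom σ x → (∀ x' → Dom σ x' → ren α x' ≡ ren α x → x' ≡ x) →
                       ∀ xs → x ∈ xs → variantAt α σ xs (ren α x) ≡ renT α (app σ x)
  variantAt-at-image α σ {x} x∈Dom unique (x₀ ∷ xs) x∈ with ren α x₀ ≟ ren α x | isVar? (app σ x₀) x₀
  ... | yes αx₀≡αx | no x₀∈Dom with unique x₀ x₀∈Dom αx₀≡αx
  ...   | refl = refl
  variantAt-at-image α σ x∈Dom unique (x₀ ∷ xs) x∈ | yes _ | yes σx₀≡x₀ =
    variantAt-at-image α σ x∈Dom unique xs (∈-tail x∈ (λ { refl → x∈Dom σx₀≡x₀ }))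
  variantAt-at-image α σ x∈Dom unique (x₀ ∷ xs) x∈ | no αx₀≢αx | _ =
    variantAt-at-image α σ x∈Dom unique xs (∈-tail x∈ (λ { refl → αx₀≢αx refl }))

  -- If x ∈ Dom(σ), injectivity on indom(α) makes x the unique domain variable
  -- over α(x); otherwise σ(x) = x and no domain variable is sent to α(x).
  variant-at-image : ∀ α (σ : Subst F) → DomSafe α σ → ∀ {x} → indom α x →
                     app (variant α σ) (ren α x) ≡ renT α (app σ x)
  variant-at-image α σ dsafe {x} ix with isVar? (app σ x) x
  ... | no x∈Dom = variantAt-at-image α σ x∈Dom unique (supp σ) (supp-ok σ x x∈Dom)
    where
    unique : ∀ x' → Dom σ x' → ren α x' ≡ ren α x → x' ≡ x
    unique x' x'∈Dom = indom-injective α (dsafe x' x'∈Dom) ix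
  ... | yes σx≡x rewrite σx≡x = variant-off-image α σ off-image
    where
    off-image : ∀ x' → Dom σ x' → ren α x' ≢ ren α x
    off-image x' x'∈Dom αx'≡αx with indom-injective α (dsafe x' x'∈Dom) ix αx'≡αx
    ... | refl = x'∈Dom σx≡x

  variant-renT : ∀ α (σ : Subst F) → DomSafe α σ → ∀ t → (∀ z → z ∈vars t → indom α z) →
                 app (variant α σ) ⟪ renT α t ⟫ ≡ renT α (app σ ⟪ t ⟫)
  variant-renT α σ dsafe t t-indom = begin
    app (variant α σ) ⟪ renT α t ⟫                ≡⟨ subst-comp (app (variant α σ)) (λ z → var (ren α z)) t ⟩
    (λ z → app (variant α σ) (ren α z)) ⟪ t ⟫     ≡⟨ subst-cong _ _ t (λ z z∈t → variant-at-image α σ dsafe (t-indom z z∈t)) ⟩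
    (λ z → renT α (app σ z)) ⟪ t ⟫                ≡⟨ sym (subst-comp (λ z → var (ren α z)) (app σ) t) ⟩
    renT α (app σ ⟪ t ⟫)                          ∎
    where open ≡-Reasoning

  image? : ∀ α (σ θ : Subst F) y →
           Σ ℕ (λ x → (Dom σ x ⊎ Dom θ x) × ren α x ≡ y) ⊎ (∀ x → Dom σ x ⊎ Dom θ x → ren α x ≢ y)
  image? α σ θ y with any? (λ x → (Dom? σ x ⊎-dec Dom? θ x) ×-dec (ren α x ≟ y)) (supp σ ++ supp θ)
  ... | yes found = let x , _ , hit = find found in inj₁ (x , hit)
  ... | no none   = inj₂ (λ x x∈Dom αx≡y → none (lose (in-supports x x∈Dom) (x∈Dom , αx≡y)))
    where
    in-supports : ∀ x → Dom σ x ⊎ Dom θ x → x ∈ supp σ ++ supp θ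
    in-supports x (inj₁ x∈Domσ) = ∈-++⁺ˡ (supp-ok σ x x∈Domσ)
    in-supports x (inj₂ x∈Domθ) = ∈-++⁺ʳ (supp σ) (supp-ok θ x x∈Domθ)

mainTheorem6 : ∀ {F} (σ θ : Subst F) (α : Prenaming) →
    Safe α σ → Safe α θ →
    variant α (σ ∘ˢ θ) ≐ (variant α σ ∘ˢ variant α θ)
mainTheorem6 σ θ α safeσ safeθ y with image? α σ θ y
... | inj₁ (x , x∈Dom , refl) = begin
  app (variant α (σ ∘ˢ θ)) (ren α x)              ≡⟨ variant-at-image α (σ ∘ˢ θ) dsafe-∘ ix ⟩
  renT α (app σ ⟪ app θ x ⟫)                      ≡⟨ sym (variant-renT α σ dsafeσ (app θ x) (Safe⇒vars-indom α θ safeθ ix)) ⟩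
  app (variant α σ) ⟪ renT α (app θ x) ⟫          ≡⟨ cong (app (variant α σ) ⟪_⟫) (sym (variant-at-image α θ dsafeθ ix)) ⟩
  app (variant α σ) ⟪ app (variant α θ) (ren α x) ⟫ ∎
  where
  open ≡-Reasoning
  dsafeσ : DomSafe α σ
  dsafeσ = Safe⇒DomSafe α σ safeσ
  dsafeθ : DomSafe α θ
  dsafeθ = Safe⇒DomSafe α θ safeθ
  dsafe-∘ : DomSafe α (σ ∘ˢ θ)
  dsafe-∘ z z∈Dom = [ dsafeσ z , dsafeθ z ] (Dom-∘ σ θ z∈Dom)
  ix : indom α x
  ix = [ dsafeσ x , dsafeθ x ] x∈Dom
... | inj₂ off-image = begin
  app (variant α (σ ∘ˢ θ)) y                      ≡⟨ variant-off-image α (σ ∘ˢ θ) (λ x x∈Dom → off-image x (Dom-∘ σ θ x∈Dom)) ⟩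
  var y                                           ≡⟨ sym (variant-off-image α σ (λ x x∈Dom → off-image x (inj₁ x∈Dom))) ⟩
  app (variant α σ) ⟪ var y ⟫                     ≡⟨ cong (app (variant α σ) ⟪_⟫) (sym (variant-off-image α θ (λ x x∈Dom → off-image x (inj₂ x∈Dom)))) ⟩
  app (variant α σ) ⟪ app (variant α θ) y ⟫       ∎
  where open ≡-Reasoning
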